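{- The equation $a^a=(2b)^b$ has no solution in positive integers $a,b$. -}

module Defs where

module Submission where

-- Suppose a ^ a ≡ (2b) ^ b with a, b positive.
--  * Comparing sizes pins a strictly between b and 2b: if a ≤ b the left
--    side is at most b ^ b < (2b) ^ b, and if 2b ≤ a the right side is
--    less than (2b) ^ a ≤ a ^ a.
--  * An equation a ^ a ≡ c ^ b with b ≤ a forces a ∣ c: write a = v g and
--    c = u g with g = gcd a c and v, u coprime; cancelling g ^ b leaves
--    v ^ a * g ^ (a ∸ b) ≡ u ^ b, so v divides a power of the coprime u,
--    whence v ≡ 1 and a = g divides c.
--  * But a proper divisor of 2b is at most b, contradicting b < a.

open import Defs
open import Data.Nat using (ℕ; _*_; _^_; _<_)
open import Relation.Binary.PropositionalEquality using (_≡_)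
open import Relation.Nullary using (¬_)

open import Data.Nat using (suc; _+_; _∸_; _≤_; NonZero; ≢-nonZero; >-nonZero)
open import Data.Nat.Properties
open import Data.Nat.Divisibility
open import Data.Nat.DivMod using (_/_; m/n*n≡m)
open import Data.Nat.GCD using (gcd; gcd[m,n]∣m; gcd[m,n]∣n; gcd[m,n]≢0)
open import Data.Nat.Coprimality using (Coprime; coprime-/gcd; coprime-divisor)
open import Data.Sum using (inj₁)
open import Relation.Nullary using (yes; no; contradiction)
open import Relation.Binary.PropositionalEquality using (refl; sym; cong; subst; module ≡-Reasoning)

^-distribʳ-* : ∀ x y n → (x * y) ^ n ≡ x ^ n * y ^ n
^-distribʳ-* x y 0       = refl
^-distribʳ-* x y (suc n) = begin
  (x * y) * (x * y) ^ n     ≡⟨ cong ((x * y) *_) (^-distribʳ-* x y n) ⟩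
  (x * y) * (x ^ n * y ^ n) ≡⟨ [m*n]*[o*p]≡[m*o]*[n*p] x y (x ^ n) (y ^ n) ⟩
  (x * x ^ n) * (y * y ^ n) ∎
  where open ≡-Reasoning

coprime-∣-pow⇒≡1 : ∀ {v u} → Coprime v u → ∀ n → v ∣ u ^ n → v ≡ 1
coprime-∣-pow⇒≡1 v⊥u 0       v∣1    = ∣1⇒≡1 v∣1
coprime-∣-pow⇒≡1 v⊥u (suc n) v∣u*uⁿ = coprime-∣-pow⇒≡1 v⊥u n (coprime-divisor v⊥u v∣u*uⁿ)

proper-divisor⇒double≤ : ∀ {a c} → a ∣ c → a < c → 2 * a ≤ c
proper-divisor⇒double≤ {a} {c} a∣c a<c = begin
  2 * a              ≤⟨ *-monoˡ-≤ a (quotient>1 a∣c a<c) ⟩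
  quotient a∣c * a   ≡⟨ sym (m∣n⇒n≡quotient*m a∣c) ⟩
  c                  ∎
  where open ≤-Reasoning

power-equation⇒exponent> : ∀ {a b c} → 0 < b → b < c → a ^ a ≡ c ^ b → b < a
power-equation⇒exponent> {a} {b@(suc _)} {c} _ b<c eq with b <? a
... | yes b<a = b<a
... | no  b≮a = contradiction eq (<⇒≢ (begin-strict
  a ^ a ≤⟨ ^-monoˡ-≤ a a≤b ⟩
  b ^ a ≤⟨ ^-monoʳ-≤ b a≤b ⟩
  b ^ b <⟨ ^-monoˡ-< b b<c ⟩
  c ^ b ∎))
  where open ≤-Reasoning
        a≤b : a ≤ b
        a≤b = ≮⇒≥ b≮a

power-equation⇒base> : ∀ {a b c} → 1 < c → b < a → a ^ a ≡ c ^ b → a < c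
power-equation⇒base> {a} {b} {c} 1<c b<a eq with a <? c
... | yes a<c = a<c
... | no  a≮c = contradiction (sym eq) (<⇒≢ (begin-strict
  c ^ b <⟨ ^-monoʳ-< c 1<c b<a ⟩
  c ^ a ≤⟨ ^-monoˡ-≤ a (≮⇒≥ a≮c) ⟩
  a ^ a ∎))
  where open ≤-Reasoning

power-equation⇒∣ : ∀ {a b c} → 0 < a → b ≤ a → a ^ a ≡ c ^ b → a ∣ c
power-equation⇒∣ {a@(suc a′)} {b} {c} _ b≤a eq = subst (_∣ c) g≡a (gcd[m,n]∣n a c)
  where
  g : ℕ
  g = gcd a c
  instance
    g≢0 : NonZero g
    g≢0 = ≢-nonZero (gcd[m,n]≢0 a c (inj₁ λ ()))
    gᵇ≢0 : NonZero (g ^ b)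
    gᵇ≢0 = m^n≢0 g b
  v u : ℕ
  v = a / g
  u = c / g
  v*g≡a : v * g ≡ a
  v*g≡a = m/n*n≡m (gcd[m,n]∣m a c)
  u*g≡c : u * g ≡ c
  u*g≡c = m/n*n≡m (gcd[m,n]∣n a c)
  reduced : v ^ a * g ^ (a ∸ b) ≡ u ^ b
  reduced = *-cancelʳ-≡ _ _ (g ^ b) (begin
    v ^ a * g ^ (a ∸ b) * g ^ b   ≡⟨ *-assoc (v ^ a) _ _ ⟩
    v ^ a * (g ^ (a ∸ b) * g ^ b) ≡⟨ cong (v ^ a *_) (sym (^-distribˡ-+-* g (a ∸ b) b)) ⟩
    v ^ a * g ^ (a ∸ b + b)       ≡⟨ cong (λ e → v ^ a * g ^ e) (m∸n+n≡m b≤a) ⟩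
    v ^ a * g ^ a                 ≡⟨ sym (^-distribʳ-* v g a) ⟩
    (v * g) ^ a                   ≡⟨ cong (_^ a) v*g≡a ⟩
    a ^ a                         ≡⟨ eq ⟩
    c ^ b                         ≡⟨ cong (_^ b) (sym u*g≡c) ⟩
    (u * g) ^ b                   ≡⟨ ^-distribʳ-* u g b ⟩
    u ^ b * g ^ b                 ∎)
    where open ≡-Reasoning
  v∣uᵇ : v ∣ u ^ b
  v∣uᵇ = subst (v ∣_) reduced (∣m⇒∣m*n (g ^ (a ∸ b)) (m∣m*n (v ^ a′)))
  v≡1 : v ≡ 1
  v≡1 = coprime-∣-pow⇒≡1 (coprime-/gcd a c) b v∣uᵇ
  g≡a : g ≡ a
  g≡a = begin
    g     ≡⟨ sym (*-identityˡ g) ⟩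
    1 * g ≡⟨ cong (_* g) (sym v≡1) ⟩
    v * g ≡⟨ v*g≡a ⟩
    a     ∎
    where open ≡-Reasoning

mainTheorem7 : (a b : ℕ) → 0 < a → 0 < b → ¬ (a ^ a ≡ (2 * b) ^ b)
mainTheorem7 a b 0<a 0<b eq = <⇒≱ b<a (*-cancelˡ-≤ 2 2a≤2b)
  where
  b<a : b < a
  b<a = power-equation⇒exponent> 0<b b<2b eq
    where b<2b : b < 2 * b
          b<2b = subst (_< 2 * b) (*-identityˡ b) (*-monoˡ-< b {{>-nonZero 0<b}} {1} {2} ≤-refl)
  a<2b : a < 2 * b
  a<2b = power-equation⇒base> (*-monoʳ-≤ 2 0<b) b<a eq
  2a≤2b : 2 * a ≤ 2 * b
  2a≤2b = proper-divisor⇒double≤ (power-equation⇒∣ 0<a (<⇒≤ b<a) eq) a<2b
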